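{- For relations $\langle R,X\rangle$ and $\langle S,Y\rangle$ with $X\cap Y=\emptyset$, $E(\langle R,X\rangle+\langle S,Y\rangle)=E\langle R,X\rangle+E\langle S,Y\rangle$, where the $+$ on the right is the shuffle sum of relationships.
   Context: A relation is a pair $\langle R,X\rangle$ with $R\subseteq X^2$. For $X\cap Y=\emptyset$, $\langle R,X\rangle+\langle S,Y\rangle=\langle R\cup S,X\cup Y\rangle$. A relationship on $X$ is a pair $[U,X]$ with $U\subseteq\mathcal P(X^2)$. $E\langle R,X\rangle=[\{R'\subseteq X^2\mid R\subseteq R'\},X]$. For relationships $[U,X],[V,Y]$ with $X\cap Y=\emptyset$, the shuffle sum is $[U,X]+[V,Y]=[\{Q\subseteq(X\cup Y)^2\mid\exists R\in U\,\exists S\in V\,(Q\cap X^2=R\ \&\ Q\cap Y^2=S)\},X\cup Y]$. -}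

module Defs where

open import Level using (0ℓ; Lift; lift) renaming (suc to lsuc)
open import Data.Product using (_×_; _,_; ∃; Σ-syntax; ∃-syntax; proj₁; proj₂)
open import Data.Empty using (⊥)
open import Relation.Unary using (Pred; _⊆_; _∪_; _∩_; _≐_; _∈_)
open import Function.Bundles using (_⇔_)

-- All sets live inside an ambient type A; a "set" X is a predicate on A,
-- a binary relation on A is a predicate on A × A.

Subset : Set → Set₁
Subset A = Pred A 0ℓ

BinRel : Set → Set₁
BinRel A = Pred (A × A) 0ℓ

_² : {A : Set} → Subset A → BinRel A
(X ²) (a , b) = X a × X b

Disjoint : {A : Set} → Subset A → Subset A → Set
Disjoint X Y = ∀ a → X a → Y a → ⊥

record Relation (A : Set) : Set₁ where
  constructor ⟨_,_⟩[_]
  field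
    rel  : BinRel A
    dom  : Subset A
    rel⊆ : rel ⊆ (dom ²)
open Relation public

record Relationship (A : Set) : Set₂ where
  constructor [_,_][_]
  field
    sets  : Pred (BinRel A) (lsuc 0ℓ)
    rdom  : Subset A
    sets⊆ : ∀ Q → Q ∈ sets → Q ⊆ (rdom ²)
open Relationship public

_≈R_ : {A : Set} → Relationship A → Relationship A → Set₁
P ≈R P' = (rdom P ≐ rdom P') × (∀ Q → (sets P Q ⇔ sets P' Q))

_+Rel_ : {A : Set} → Relation A → Relation A → Relation A
⟨ R , X ⟩[ hR ] +Rel ⟨ S , Y ⟩[ hS ] = ⟨ R ∪ S , X ∪ Y ⟩[ h ]
  where
  open import Data.Sum using (inj₁; inj₂)
  h : R ∪ S ⊆ ((X ∪ Y) ²)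
  h (inj₁ r) = inj₁ (proj₁ (hR r)) , inj₁ (proj₂ (hR r))
  h (inj₂ s) = inj₂ (proj₁ (hS s)) , inj₂ (proj₂ (hS s))

E : {A : Set} → Relation A → Relationship A
E ⟨ R , X ⟩[ _ ] = [ (λ R' → Lift (lsuc 0ℓ) ((R ⊆ R') × (R' ⊆ (X ²)))) , X ][ (λ Q q → proj₂ (Lift.lower q)) ]

_+Sh_ : {A : Set} → Relationship A → Relationship A → Relationship A
[ U , X ][ _ ] +Sh [ V , Y ][ _ ] =
  [ (λ Q → (Q ⊆ ((X ∪ Y) ²)) ×
           (∃[ R ] ∃[ S ] (U R × V S × ((Q ∩ (X ²)) ≐ R) × ((Q ∩ (Y ²)) ≐ S))))
  , X ∪ Y ][ (λ Q q → proj₁ q) ]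

module Submission where

-- Both relationships live on X ∪ Y, so only their families need comparing.
-- A relation Q ⊆ (X ∪ Y)² extends R ∪ S iff it extends R and S separately
-- (union is a least upper bound).  If Q extends R ⊆ X², then its
-- restriction Q ∩ X² still extends R, so it is a member of E⟨R,X⟩; this
-- supplies the witnesses demanded by the shuffle sum.  Conversely, a
-- witness R' ∈ E⟨R,X⟩ with R' ≐ Q ∩ X² shows R ⊆ Q.  The argument never uses
-- disjointness of X and Y: in the paper that hypothesis only makes the sum
-- of relations a meaningful operation, the identity holds regardless.

open import Defs
open import Level using (Level; lift)
open import Data.Product using (_,_; proj₁; proj₂)
open import Data.Sum using (inj₁; inj₂)
open import Function.Bundles using (mk⇔)
open import Relation.Unary using (Pred; _⊆_; _∪_; _∩_; _≐_)
open import Relation.Unary.Properties using (⊆-trans; ≐-refl)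

private
  variable
    a ℓ₁ ℓ₂ ℓ₃ : Level
    B : Set a

∪-least : {P : Pred B ℓ₁} {Q : Pred B ℓ₂} {T : Pred B ℓ₃} →
          P ⊆ T → Q ⊆ T → P ∪ Q ⊆ T
∪-least P⊆T Q⊆T (inj₁ p) = P⊆T p
∪-least P⊆T Q⊆T (inj₂ q) = Q⊆T q

∩-greatest : {P : Pred B ℓ₁} {Q : Pred B ℓ₂} {T : Pred B ℓ₃} →
             T ⊆ P → T ⊆ Q → T ⊆ P ∩ Q
∩-greatest T⊆P T⊆Q t = T⊆P t , T⊆Q t

restriction∈E : {A : Set} (ρ : Relation A) (Q : BinRel A) →
                rel ρ ⊆ Q → sets (E ρ) (Q ∩ (dom ρ ²))
restriction∈E ρ Q R⊆Q = lift (∩-greatest {P = Q} {Q = dom ρ ²} R⊆Q (rel⊆ ρ) , proj₂)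

extends-if-restriction∈E : {A : Set} (ρ : Relation A) (Q R' : BinRel A) →
                           sets (E ρ) R' → (Q ∩ (dom ρ ²)) ≐ R' → rel ρ ⊆ Q
extends-if-restriction∈E ρ Q R' (lift (R⊆R' , _)) (_ , R'⊆Q∩X²) =
  ⊆-trans {i = rel ρ} {j = R'} R⊆R' (λ r → proj₁ (R'⊆Q∩X² r))

proposition4p1 : {A : Set} (ρ σ : Relation A) →
    Disjoint (dom ρ) (dom σ) →
    E (ρ +Rel σ) ≈R (E ρ +Sh E σ)
proposition4p1 ρ@(⟨ R , X ⟩[ _ ]) σ@(⟨ S , Y ⟩[ _ ]) _ =
  ≐-refl , λ Q → mk⇔ (into Q) (outof Q)
  where
  into : ∀ Q → sets (E (ρ +Rel σ)) Q → sets (E ρ +Sh E σ) Q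
  into Q (lift (R∪S⊆Q , Q⊆[X∪Y]²)) =
    Q⊆[X∪Y]² , Q ∩ (X ²) , Q ∩ (Y ²)
    , restriction∈E ρ Q (λ r → R∪S⊆Q (inj₁ r))
    , restriction∈E σ Q (λ s → R∪S⊆Q (inj₂ s))
    , ≐-refl , ≐-refl

  outof : ∀ Q → sets (E ρ +Sh E σ) Q → sets (E (ρ +Rel σ)) Q
  outof Q (Q⊆[X∪Y]² , R' , S' , R'∈Eρ , S'∈Eσ , Q∩X²≐R' , Q∩Y²≐S') =
    lift (∪-least {P = R} {Q = S}
                  (extends-if-restriction∈E ρ Q R' R'∈Eρ Q∩X²≐R')
                  (extends-if-restriction∈E σ Q S' S'∈Eσ Q∩Y²≐S')
         , Q⊆[X∪Y]²)
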